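{- For every integer $k\ge 1$, $2\le \chi_{la}(B_k)\le 3$.
   Context: For a graph $G=(V,E)$ with $|E|=m$ and no isolated vertices, a local antimagic labeling is a bijection $f:E\to\{1,\dots,m\}$ such that $f^+(u)\ne f^+(v)$ for every edge $uv$, where $f^+(x)=\sum f(e)$ over all edges $e$ incident to $x$. The local antimagic chromatic number $\chi_{la}(G)$ is the minimum, over all local antimagic labelings $f$ of $G$, of the number of distinct values taken by $f^+$ (also for disconnected graphs). Let $C_8^*$ be the graph consisting of an 8-cycle $u_1u_2\cdots u_8u_1$ together with an additional vertex $x$ adjacent to $u_2$ and $u_6$. Let $B_8$ be the graph obtained from $C_8^*$ by identifying (merging) the vertices $u_4$ and $u_8$ into a single vertex. $B_k$ is the disjoint union of $k$ copies of $B_8$. -}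

module Defs where

open import Data.Nat using (ℕ; zero; suc; _+_; _*_; _≤_)
open import Data.Nat.Properties using (_≟_)
open import Data.Fin as Fin using (Fin; toℕ; combine; remQuot; zero; suc)
open import Data.Fin.Properties as FinP using ()
open import Data.List using (List; map; length; deduplicate; allFin)
open import Data.Nat.ListAction using (sum)
open import Data.Product using (_×_; _,_; proj₁; proj₂; ∃-syntax; Σ-syntax)
open import Data.Sum using (_⊎_)
open import Data.Empty using (⊥)
open import Relation.Nullary using (¬_; does)
open import Relation.Binary.PropositionalEquality using (_≡_)
open import Data.Bool using (if_then_else_; _∨_)
open import Function.Bundles using (_⤖_; Bijection)

record Graph : Set where
  field
    nV   : ℕ
    nE   : ℕ
    ends : Fin nE → Fin nV × Fin nV
open Graph public

incidentᵇ : (G : Graph) → Fin (nV G) → Fin (nE G) → Data.Bool.Bool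
incidentᵇ G v e = does (v FinP.≟ proj₁ (ends G e)) ∨ does (v FinP.≟ proj₂ (ends G e))

Incident : (G : Graph) → Fin (nV G) → Fin (nE G) → Set
Incident G v e = (v ≡ proj₁ (ends G e)) ⊎ (v ≡ proj₂ (ends G e))

-- An edge labeling is a bijection f : E → {1,…,m}; we encode {1,…,m} as Fin m
-- with label of e being  toℕ (f e) + 1.
Labeling : Graph → Set
Labeling G = Fin (nE G) ⤖ Fin (nE G)

label : (G : Graph) → Labeling G → Fin (nE G) → ℕ
label G f e = suc (toℕ (Bijection.to f e))

vsum : (G : Graph) → Labeling G → Fin (nV G) → ℕ
vsum G f v = sum (map (λ e → if incidentᵇ G v e then label G f e else 0) (allFin (nE G)))

IsLocalAntimagic : (G : Graph) → Labeling G → Set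
IsLocalAntimagic G f = ∀ e → ¬ (vsum G f (proj₁ (ends G e)) ≡ vsum G f (proj₂ (ends G e)))

numColors : (G : Graph) → Labeling G → ℕ
numColors G f = length (deduplicate _≟_ (map (vsum G f) (allFin (nV G))))

ChiLa : Graph → ℕ → Set
ChiLa G c =
  (Σ[ f ∈ Labeling G ] IsLocalAntimagic G f × numColors G f ≡ c) ×
  (∀ (f : Labeling G) → IsLocalAntimagic G f → c ≤ numColors G f)

-- B₈: vertices u1=0,u2=1,u3=2,w=3 (u4 merged with u8),u5=4,u6=5,u7=6,x=7
B8ends : Fin 10 → Fin 8 × Fin 8
B8ends e = table (toℕ e)
  where
  open import Data.Fin using (#_)
  table : ℕ → Fin 8 × Fin 8
  table 0 = (# 0) , (# 1)
  table 1 = (# 1) , (# 2)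
  table 2 = (# 2) , (# 3)
  table 3 = (# 3) , (# 4)
  table 4 = (# 4) , (# 5)
  table 5 = (# 5) , (# 6)
  table 6 = (# 6) , (# 3)
  table 7 = (# 3) , (# 0)
  table 8 = (# 7) , (# 1)
  table _ = (# 7) , (# 5)

B8 : Graph
B8 = record { nV = 8 ; nE = 10 ; ends = B8ends }

-- disjoint union of k copies of B₈: vertex (i , j) ↦ combine i j, edge similarly
B : ℕ → Graph
B k = record
  { nV = k * 8
  ; nE = k * 10
  ; ends = λ e → let (i , j) = remQuot {k} 10 e
                 in combine {k} i (proj₁ (B8ends j)) , combine {k} i (proj₂ (B8ends j))
  }

-- χ_la(G) exists for every graph with a local antimagic labeling: there are finitely many
-- labelings and local antimagicity is decidable, so one with fewest colours can be found; any
-- edge forces two colours. For three colours on B_k, the labels 1, …, 10k are read row by row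
-- from a 5 × 2k array in which each row holds the k copies of two edges of B₈, either as two
-- blocks or interlaced, some edges listing their copies in reverse order. The label of an edge
-- in copy i is then linear in t = i and o = k − 1 − i, and at every vertex of B₈ the
-- coefficients of t and o agree, so each vertex sum only depends on t + o = k − 1. The sums
-- are 10k + 1, 16k + 2 and 18k + 1, following a proper 3-colouring of B₈.

{-# OPTIONS --safe #-}
module Submission where

open import Defs
open import Data.Nat using (ℕ; _≤_)
open import Data.Product using (_×_; ∃-syntax)

open import Data.Bool using (Bool; true; false; if_then_else_; _∧_; _∨_)
open import Data.Bool.Properties using (∧-distribˡ-∨)
open import Data.Fin
  using (Fin; zero; suc; toℕ; combine; remQuot; opposite; _↑ˡ_; _↑ʳ_; finToFun; funToFin)
open import Data.Fin.Patterns
open import Data.Fin.Permutation using (Permutation′; _⟨$⟩ʳ_; reverse; cast-id)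
open import Data.Fin.Properties
  using (*↔×; any?; all?; toℕ-combine; toℕ-cast; remQuot-combine; combine-injectiveˡ;
         combine-injectiveʳ; combine-surjective; finToFun-funToFin; opposite-prop; toℕ<n;
         punchInᵢ≢i)
  renaming (_≟_ to _≟ᶠ_)
open import Data.List using (List; []; _∷_; map; length; deduplicate; allFin; tabulate)
open import Data.List.Membership.Propositional using (_∈_)
open import Data.List.Membership.Propositional.Properties
  using (∈-map⁺; ∈-map⁻; ∈-allFin; ∈-deduplicate⁺; ∈-deduplicate⁻)
open import Data.List.Properties using (map-cong; map-tabulate)
open import Data.List.Relation.Binary.Subset.Propositional using (_⊆_)
import Data.List.Relation.Unary.All as All
open import Data.List.Relation.Unary.AllPairs using (_∷_)
open import Data.List.Relation.Unary.Any using (here; there; _─_)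
open import Data.List.Relation.Unary.Unique.Propositional using (Unique)
open import Data.Nat
  using (zero; suc; pred; _+_; _*_; _<_; _<?_; s≤s; z≤n; z<s; NonZero; >-nonZero⁻¹)
open import Data.Nat.Induction using (Acc; acc; <-wellFounded)
open import Data.Nat.ListAction using (sum)
open import Data.Nat.Properties
  using (_≟_; m≤m+n; n<1+n; m<m+n; m+[n∸m]≡n; +-assoc; +-identityʳ; *-assoc; *-comm;
         *-distribʳ-+; +-mono-≤-<; +-monoʳ-≤; *-monoˡ-≤; *-monoʳ-≤; ≤-trans; <-trans; ≮⇒≥;
         <⇒≢; >⇒≢; +-0-commutativeMonoid; module ≤-Reasoning)
open import Algebra.Properties.CommutativeMonoid.Sum +-0-commutativeMonoid
  using (sum-syntax; sum-cong-≗; sum-replicate-zero; sum-remove)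
open import Data.List.Relation.Unary.Unique.DecPropositional.Properties _≟_ using (deduplicate-!)
open import Data.Nat.Tactic.RingSolver using (solve-∀)
open import Data.Product using (∃; Σ; _,_; proj₁; proj₂)
open import Data.Product.Algebra using (×-comm; ×-assoc)
open import Data.Product.Function.Dependent.Propositional using (Σ-↔)
open import Data.Product.Properties using (≡-dec)
open import Data.Unit using (tt)
open import Data.Vec.Functional using (removeAt)
open import Function using (_∘_; id)
open import Function.Bundles using (_↔_; _⤖_; Inverse; Bijection; mk↔ₛ′)
open import Function.Definitions using (Injective; StrictlyInverseˡ; StrictlyInverseʳ)
open import Function.Properties.Bijection using (⤖⇒↔)
open import Function.Properties.Inverse using (↔⇒⤖; ↔-sym; ↔-refl; ↔-trans)
open import Function.Related.Propositional using (module EquationalReasoning)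
open import Level using (0ℓ)
open import Relation.Binary.PropositionalEquality
open import Relation.Nullary using (Dec; yes; no; ¬?; does; contradiction)
open import Relation.Nullary.Decidable using (map′; _×-dec_; dec-true; dec-false; toWitness)
open import Relation.Unary using (Pred; Decidable)

sum-tabulate : ∀ {n} (F : Fin n → ℕ) → sum (tabulate F) ≡ ∑[ i < n ] F i
sum-tabulate {zero}  F = refl
sum-tabulate {suc n} F = cong (F zero +_) (sum-tabulate (F ∘ suc))

sum-map-allFin : ∀ {n} (F : Fin n → ℕ) → sum (map F (allFin n)) ≡ ∑[ i < n ] F i
sum-map-allFin F = trans (cong sum (map-tabulate id F)) (sum-tabulate F)

∑-zero : ∀ {n} {F : Fin n → ℕ} → (∀ i → F i ≡ 0) → ∑[ i < n ] F i ≡ 0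
∑-zero {n} F≡0 = trans (sum-cong-≗ F≡0) (sum-replicate-zero n)

∑-single : ∀ {n} (F : Fin n → ℕ) (i : Fin n) → (∀ j → j ≢ i → F j ≡ 0) →
           ∑[ j < n ] F j ≡ F i
∑-single {suc n} F i F≡0 = begin
  ∑[ j < suc n ] F j              ≡⟨ sum-remove {i = i} F ⟩
  F i + ∑[ j < n ] removeAt F i j ≡⟨ cong (F i +_) (∑-zero (λ j → F≡0 _ (punchInᵢ≢i i j))) ⟩
  F i + 0                         ≡⟨ +-identityʳ (F i) ⟩
  F i                             ∎
  where open ≡-Reasoning

∑-↑ : ∀ m {n} (F : Fin (m + n) → ℕ) →
      ∑[ e < m + n ] F e ≡ ∑[ i < m ] F (i ↑ˡ n) + ∑[ j < n ] F (m ↑ʳ j)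
∑-↑ zero    F = refl
∑-↑ (suc m) F = trans (cong (F zero +_) (∑-↑ m (F ∘ suc))) (sym (+-assoc (F zero) _ _))

∑-combine : ∀ m {n} (F : Fin (m * n) → ℕ) →
            ∑[ e < m * n ] F e ≡ ∑[ i < m ] ∑[ j < n ] F (combine i j)
∑-combine zero        F = refl
∑-combine (suc m) {n} F =
  trans (∑-↑ n F) (cong (∑[ j < n ] F (j ↑ˡ m * n) +_) (∑-combine m (F ∘ (n ↑ʳ_))))

vsumBy : (G : Graph) → (Fin (nE G) → ℕ) → Fin (nV G) → ℕ
vsumBy G w v = sum (map (λ e → if incidentᵇ G v e then w e else 0) (allFin (nE G)))

vsumBy-cong : ∀ G {w w′ : Fin (nE G) → ℕ} → w ≗ w′ → vsumBy G w ≗ vsumBy G w′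
vsumBy-cong G w≗w′ v = cong sum (map-cong
  (λ e → cong (λ x → if incidentᵇ G v e then x else 0) (w≗w′ e)) (allFin (nE G)))

distinct-∈⇒2≤length : ∀ {A : Set} {x y : A} {xs} →
                       x ∈ xs → y ∈ xs → x ≢ y → 2 ≤ length xs
distinct-∈⇒2≤length {xs = _ ∷ _ ∷ _} _           _           _   = s≤s (s≤s z≤n)
distinct-∈⇒2≤length {xs = _ ∷ []}    (here refl) (here refl) x≢y = contradiction refl x≢y

2≤numColors : ∀ G (f : Labeling G) → Fin (nE G) → IsLocalAntimagic G f → 2 ≤ numColors G f
2≤numColors G f e antimagic =
  distinct-∈⇒2≤length (colour (proj₁ (ends G e))) (colour (proj₂ (ends G e))) (antimagic e)
  where
  colour : ∀ v → vsum G f v ∈ deduplicate _≟_ (map (vsum G f) (allFin (nV G)))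
  colour v = ∈-deduplicate⁺ _≟_ (∈-map⁺ (vsum G f) (∈-allFin v))

module _ {A : Set} where

  length-─ : ∀ {x : A} {ys} (x∈ys : x ∈ ys) → length ys ≡ suc (length (ys ─ x∈ys))
  length-─ (here _)                  = refl
  length-─ {ys = _ ∷ _} (there x∈ys) = cong suc (length-─ x∈ys)

  ∈-─ : ∀ {x y : A} {ys} (x∈ys : x ∈ ys) → y ∈ ys → y ≢ x → y ∈ (ys ─ x∈ys)
  ∈-─ (here refl)  (here refl)  y≢x = contradiction refl y≢x
  ∈-─ (here refl)  (there y∈ys) _   = y∈ys
  ∈-─ (there _)    (here refl)  _   = here refl
  ∈-─ (there x∈ys) (there y∈ys) y≢x = there (∈-─ x∈ys y∈ys y≢x)

  unique-⊆⇒length≤ : ∀ {xs ys : List A} → Unique xs → xs ⊆ ys → length xs ≤ length ys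
  unique-⊆⇒length≤ {[]}          _               _     = z≤n
  unique-⊆⇒length≤ {x ∷ xs} {ys} (x≢xs ∷ unique) xs⊆ys = begin
    suc (length xs)          ≤⟨ s≤s (unique-⊆⇒length≤ unique rest) ⟩
    suc (length (ys ─ x∈ys)) ≡⟨ length-─ x∈ys ⟨
    length ys                ∎
    where
    open ≤-Reasoning
    x∈ys : x ∈ ys
    x∈ys = xs⊆ys (here refl)
    rest : xs ⊆ (ys ─ x∈ys)
    rest y∈xs = ∈-─ x∈ys (xs⊆ys (there y∈xs)) (≢-sym (All.lookup x≢xs y∈xs))

numColors≤length : ∀ G (f : Labeling G) (cs : List ℕ) →
                   (∀ v → vsum G f v ∈ cs) → numColors G f ≤ length cs
numColors≤length G f cs vsum∈cs = unique-⊆⇒length≤ (deduplicate-! _) colours⊆cs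
  where
  colours⊆cs : deduplicate _≟_ (map (vsum G f) (allFin (nV G))) ⊆ cs
  colours⊆cs c∈ with v , _ , refl ← ∈-map⁻ (vsum G f) (∈-deduplicate⁻ _≟_ _ c∈) = vsum∈cs v

-- Existence of χ_la by exhaustive search

∃-function? : ∀ {m n p} {P : Pred (Fin m → Fin n) p} →
              (∀ {f g} → f ≗ g → P f → P g) → Decidable P → Dec (∃ P)
∃-function? P-resp P? =
  map′ (λ (c , Pc) → finToFun c , Pc)
       (λ (f , Pf) → funToFin f , P-resp (sym ∘ finToFun-funToFin f) Pf)
       (any? (P? ∘ finToFun))

InversePair : ∀ {n} → (Fin n → Fin n) → (Fin n → Fin n) → Set
InversePair h g = StrictlyInverseˡ _≡_ h g × StrictlyInverseʳ _≡_ h g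

InversePair-resp : ∀ {n} {h h′ g g′ : Fin n → Fin n} →
                   h ≗ h′ → g ≗ g′ → InversePair h g → InversePair h′ g′
InversePair-resp {h = h} {h′} {g} {g′} h≗h′ g≗g′ (hg , gh) =
  (λ y → trans (sym (h≗h′ (g′ y))) (trans (cong h (sym (g≗g′ y))) (hg y))) ,
  (λ x → trans (sym (g≗g′ (h′ x))) (trans (cong g (sym (h≗h′ x))) (gh x)))

inversePair? : ∀ {n} (h g : Fin n → Fin n) → Dec (InversePair h g)
inversePair? h g = all? (λ y → h (g y) ≟ᶠ y) ×-dec all? (λ x → g (h x) ≟ᶠ x)

toBijection : ∀ {n} (h g : Fin n → Fin n) → InversePair h g → Fin n ⤖ Fin n
toBijection h g (hg , gh) = ↔⇒⤖ (mk↔ₛ′ h g hg gh)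

module _ {n p} {P : Pred (Fin n ⤖ Fin n) p}
         (P-resp : ∀ {f g} → Bijection.to f ≗ Bijection.to g → P f → P g)
         (P? : Decidable P) where

  private
    WithInverse : (Fin n → Fin n) → (Fin n → Fin n) → Set p
    WithInverse h g = Σ (InversePair h g) (P ∘ toBijection h g)

    withInverse? : ∀ h g → Dec (WithInverse h g)
    withInverse? h g with inversePair? h g
    ... | no ¬inverse = no (¬inverse ∘ proj₁)
    ... | yes inverse =
      map′ (inverse ,_) (λ (_ , Pf) → P-resp (λ _ → refl) Pf) (P? (toBijection h g inverse))

  ∃-bijection? : Dec (∃ P)
  ∃-bijection? = map′
    (λ (h , g , inverse , Pf) → toBijection h g inverse , Pf)
    (λ (f , Pf) → let open Inverse (⤖⇒↔ f) in
      to , from , (strictlyInverseˡ , strictlyInverseʳ) , P-resp (λ _ → refl) Pf)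
    (∃-function? ∃WithInverse-resp λ h → ∃-function? (WithInverse-resp h) (withInverse? h))
    where
    WithInverse-resp : ∀ h {g g′} → g ≗ g′ → WithInverse h g → WithInverse h g′
    WithInverse-resp h g≗g′ (inverse , Pf) =
      InversePair-resp (λ _ → refl) g≗g′ inverse , P-resp (λ _ → refl) Pf
    ∃WithInverse-resp : ∀ {h h′} → h ≗ h′ → ∃ (WithInverse h) → ∃ (WithInverse h′)
    ∃WithInverse-resp h≗h′ (g , inverse , Pf) =
      g , InversePair-resp h≗h′ (λ _ → refl) inverse , P-resp h≗h′ Pf

module _ (G : Graph) where

  isLocalAntimagic? : Decidable (IsLocalAntimagic G)
  isLocalAntimagic? f =
    all? λ e → ¬? (vsum G f (proj₁ (ends G e)) ≟ vsum G f (proj₂ (ends G e)))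

  antimagicWithFewerColours? : ∀ m → Dec (∃[ f ] (IsLocalAntimagic G f × numColors G f < m))
  antimagicWithFewerColours? m =
    ∃-bijection? (λ {f} {g} → preserved {f} {g})
                 (λ f → isLocalAntimagic? f ×-dec numColors G f <? m)
    where
    preserved : ∀ {f g} → Bijection.to f ≗ Bijection.to g →
                IsLocalAntimagic G f × numColors G f < m → IsLocalAntimagic G g × numColors G g < m
    preserved {f} {g} to≗ (antimagic , fewer) = antimagic′ , subst (_< m) colours≡ fewer
      where
      vsum≗ : vsum G f ≗ vsum G g
      vsum≗ = vsumBy-cong G (cong (suc ∘ toℕ) ∘ to≗)
      antimagic′ : IsLocalAntimagic G g
      antimagic′ e eq =
        antimagic e (trans (vsum≗ (proj₁ (ends G e))) (trans eq (sym (vsum≗ (proj₂ (ends G e))))))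
      colours≡ : numColors G f ≡ numColors G g
      colours≡ = cong (length ∘ deduplicate _≟_) (map-cong vsum≗ (allFin (nV G)))

  chiLa-exists : ∀ f → IsLocalAntimagic G f → ∃ (ChiLa G)
  chiLa-exists f = fewest f (<-wellFounded (numColors G f))
    where
    fewest : ∀ f → Acc _<_ (numColors G f) → IsLocalAntimagic G f → ∃ (ChiLa G)
    fewest f (acc smaller) antimagic with antimagicWithFewerColours? (numColors G f)
    ... | yes (g , antimagic′ , fewer) = fewest g (smaller fewer) antimagic′
    ... | no none = numColors G f , (f , antimagic , refl) ,
                    λ g antimagic′ → ≮⇒≥ (λ fewer → none (g , antimagic′ , fewer))

  chiLa≥2 : ∀ {c} → Fin (nE G) → ChiLa G c → 2 ≤ c
  chiLa≥2 e ((f , antimagic , refl) , _) = 2≤numColors G f e antimagic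

-- Disjoint copies of a graph

-- B k is Copies k B8 by definition.
Copies : ℕ → Graph → Graph
Copies k H = record
  { nV   = k * nV H
  ; nE   = k * nE H
  ; ends = λ e → let (i , j) = remQuot {k} (nE H) e
                 in combine i (proj₁ (ends H j)) , combine i (proj₂ (ends H j))
  }

does-combine-≟ : ∀ {m n} (i i′ : Fin m) (v w : Fin n) →
                 does (combine i v ≟ᶠ combine i′ w) ≡ does (i ≟ᶠ i′) ∧ does (v ≟ᶠ w)
does-combine-≟ i i′ v w with i ≟ᶠ i′ | v ≟ᶠ w
... | yes refl | yes refl = dec-true (combine i v ≟ᶠ combine i v) refl
... | yes refl | no v≢w   =
  dec-false (combine i v ≟ᶠ combine i w) (v≢w ∘ combine-injectiveʳ i v i w)
... | no i≢i′  | _        =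
  dec-false (combine i v ≟ᶠ combine i′ w) (i≢i′ ∘ combine-injectiveˡ i v i′ w)

incidentᵇ-Copies : ∀ k H (i i′ : Fin k) v e →
                   incidentᵇ (Copies k H) (combine i v) (combine i′ e) ≡
                   does (i ≟ᶠ i′) ∧ incidentᵇ H v e
incidentᵇ-Copies k H i i′ v e = begin
  incidentᵇ (Copies k H) (combine i v) (combine i′ e)
    ≡⟨ cong (λ (i″ , e″) → does (combine i v ≟ᶠ combine i″ (proj₁ (ends H e″))) ∨
                           does (combine i v ≟ᶠ combine i″ (proj₂ (ends H e″))))
            (remQuot-combine i′ e) ⟩
  does (combine i v ≟ᶠ combine i′ a) ∨ does (combine i v ≟ᶠ combine i′ b)
    ≡⟨ cong₂ _∨_ (does-combine-≟ i i′ v a) (does-combine-≟ i i′ v b) ⟩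
  (does (i ≟ᶠ i′) ∧ does (v ≟ᶠ a)) ∨ (does (i ≟ᶠ i′) ∧ does (v ≟ᶠ b))
    ≡⟨ ∧-distribˡ-∨ (does (i ≟ᶠ i′)) _ _ ⟨
  does (i ≟ᶠ i′) ∧ incidentᵇ H v e
    ∎
  where
  open ≡-Reasoning
  a b : Fin (nV H)
  a = proj₁ (ends H e)
  b = proj₂ (ends H e)

vsumBy-Copies : ∀ k H (w : Fin (k * nE H) → ℕ) i v →
                vsumBy (Copies k H) w (combine i v) ≡ vsumBy H (w ∘ combine i) v
vsumBy-Copies k H w i v = begin
  vsumBy (Copies k H) w (combine i v)        ≡⟨ sum-map-allFin F ⟩
  ∑[ e < k * nE H ] F e                     ≡⟨ ∑-combine k F ⟩
  ∑[ i′ < k ] ∑[ e < nE H ] F (combine i′ e) ≡⟨ ∑-single _ i (λ i′ → ∑-zero ∘ otherCopy i′) ⟩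
  ∑[ e < nE H ] F (combine i e)              ≡⟨ sum-cong-≗ sameCopy ⟩
  ∑[ e < nE H ] Fᴴ e                         ≡⟨ sum-map-allFin Fᴴ ⟨
  vsumBy H (w ∘ combine i) v                 ∎
  where
  open ≡-Reasoning
  F : Fin (k * nE H) → ℕ
  F e = if incidentᵇ (Copies k H) (combine i v) e then w e else 0
  Fᴴ : Fin (nE H) → ℕ
  Fᴴ e = if incidentᵇ H v e then w (combine i e) else 0
  otherCopy : ∀ i′ → i′ ≢ i → ∀ e → F (combine i′ e) ≡ 0
  otherCopy i′ i′≢i e
    rewrite incidentᵇ-Copies k H i i′ v e | dec-false (i ≟ᶠ i′) (i′≢i ∘ sym) = refl
  sameCopy : ∀ e → F (combine i e) ≡ Fᴴ e
  sameCopy e rewrite incidentᵇ-Copies k H i i v e | dec-true (i ≟ᶠ i) refl = refl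

Copies-isLocalAntimagic : ∀ {k H} (f : Labeling (Copies k H)) (s : Fin (nV H) → ℕ) →
                          (∀ i v → vsum (Copies k H) f (combine i v) ≡ s v) →
                          (∀ e → s (proj₁ (ends H e)) ≢ s (proj₂ (ends H e))) →
                          IsLocalAntimagic (Copies k H) f
Copies-isLocalAntimagic {k} {H} f s vsum≡s s-proper e eq =
  s-proper j (trans (sym (vsum≡s i (proj₁ (ends H j)))) (trans eq (vsum≡s i (proj₂ (ends H j)))))
  where
  i : Fin k
  i = proj₁ (remQuot {k} (nE H) e)
  j : Fin (nE H)
  j = proj₂ (remQuot {k} (nE H) e)

-- A labeling of B k with three vertex sums

position : Fin 10 → Fin 5 × Fin 2
position 0F = 4F , 1F
position 1F = 1F , 0F
position 2F = 3F , 1F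
position 3F = 0F , 1F
position 4F = 4F , 0F
position 5F = 1F , 1F
position 6F = 3F , 0F
position 7F = 0F , 0F
position 8F = 2F , 0F
position 9F = 2F , 1F

edgeAt : Fin 5 × Fin 2 → Fin 10
edgeAt (0F , 0F) = 7F
edgeAt (0F , 1F) = 3F
edgeAt (1F , 0F) = 1F
edgeAt (1F , 1F) = 5F
edgeAt (2F , 0F) = 8F
edgeAt (2F , 1F) = 9F
edgeAt (3F , 0F) = 6F
edgeAt (3F , 1F) = 2F
edgeAt (4F , 0F) = 4F
edgeAt (4F , 1F) = 0F

row : Fin 10 → Fin 5
row = proj₁ ∘ position

side : Fin 10 → Fin 2
side = proj₂ ∘ position

position-edgeAt : ∀ pb → position (edgeAt pb) ≡ pb
position-edgeAt (p , b) = toWitness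
  {a? = all? λ p → all? λ b → ≡-dec _≟ᶠ_ _≟ᶠ_ (position (edgeAt (p , b))) (p , b)} tt p b

edgeAt-position : ∀ j → edgeAt (position j) ≡ j
edgeAt-position = toWitness {a? = all? λ j → edgeAt (position j) ≟ᶠ j} tt

slot : Fin 10 ↔ (Fin 5 × Fin 2)
slot = mk↔ₛ′ position edgeAt position-edgeAt edgeAt-position

reversed : Fin 10 → Bool
reversed 0F = true
reversed 2F = true
reversed 3F = true
reversed 5F = true
reversed 9F = true
reversed _  = false

orientation : ∀ {k} → Bool → Permutation′ k
orientation true  = reverse
orientation false = ↔-refl

data Layout : Set where
  blocks     : Layout
  interlaced : Layout

rowLayout : Fin 5 → Layout
rowLayout 0F = interlaced
rowLayout 4F = interlaced
rowLayout _  = blocks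

layout : ∀ k → Layout → (Fin 2 × Fin k) ↔ Fin (2 * k)
layout k blocks     = ↔-sym *↔×
layout k interlaced = begin
  (Fin 2 × Fin k) ↔⟨ ×-comm _ _ ⟩
  (Fin k × Fin 2) ↔⟨ ↔-sym *↔× ⟩
  Fin (k * 2)     ↔⟨ cast-id (*-comm k 2) ⟩
  Fin (2 * k)     ∎
  where open EquationalReasoning

column : Layout → (k b x : ℕ) → ℕ
column blocks     k b x = k * b + x
column interlaced k b x = 2 * x + b

5*[2*k]≡k*10 : ∀ k → 5 * (2 * k) ≡ k * 10
5*[2*k]≡k*10 k = trans (sym (*-assoc 5 2 k)) (*-comm 10 k)

labelIndex : ∀ k → (Fin k × Fin 10) ↔ Fin (k * 10)
labelIndex k = begin
  (Fin k × Fin 10)          ↔⟨ ×-comm _ _ ⟩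
  (Fin 10 × Fin k)          ↔⟨ Σ-↔ slot (λ {j} → orientation (reversed j)) ⟩
  ((Fin 5 × Fin 2) × Fin k) ↔⟨ ×-assoc 0ℓ _ _ _ ⟩
  (Fin 5 × (Fin 2 × Fin k)) ↔⟨ Σ-↔ ↔-refl (λ {p} → layout k (rowLayout p)) ⟩
  (Fin 5 × Fin (2 * k))     ↔⟨ ↔-sym *↔× ⟩
  Fin (5 * (2 * k))         ↔⟨ cast-id (5*[2*k]≡k*10 k) ⟩
  Fin (k * 10)              ∎
  where open EquationalReasoning

labeling : ∀ k → Labeling (B k)
labeling k = ↔⇒⤖ (↔-trans *↔× (labelIndex k))

-- The label of edge j in copy i, for t = i and o = k − 1 − i.
edgeLabel : (k t o : ℕ) → Fin 10 → ℕ
edgeLabel k t o j = suc (2 * k * toℕ (row j) +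
                         column (rowLayout (row j)) k (toℕ (side j)) (if reversed j then o else t))

toℕ-layout : ∀ {k} l (b : Fin 2) (x : Fin k) →
             toℕ (Inverse.to (layout k l) (b , x)) ≡ column l k (toℕ b) (toℕ x)
toℕ-layout blocks     b x = toℕ-combine b x
toℕ-layout interlaced b x = trans (toℕ-cast _ (combine x b)) (toℕ-combine x b)

toℕ-orientation : ∀ {k} b (i : Fin k) →
                  toℕ (orientation b ⟨$⟩ʳ i) ≡ (if b then toℕ (opposite i) else toℕ i)
toℕ-orientation true  i = refl
toℕ-orientation false i = refl

label-combine : ∀ k (i : Fin k) j →
                label (B k) (labeling k) (combine i j) ≡ edgeLabel k (toℕ i) (toℕ (opposite i)) j
label-combine k i j = cong suc (begin
  toℕ (Inverse.to (labelIndex k) (remQuot 10 (combine i j)))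
    ≡⟨ cong (toℕ ∘ Inverse.to (labelIndex k)) (remQuot-combine i j) ⟩
  toℕ (Inverse.to (labelIndex k) (i , j))
    ≡⟨ toℕ-cast _ (combine (row j) c) ⟩
  toℕ (combine (row j) c)
    ≡⟨ toℕ-combine (row j) c ⟩
  2 * k * toℕ (row j) + toℕ c
    ≡⟨ cong (2 * k * toℕ (row j) +_) (toℕ-layout (rowLayout (row j)) (side j) x) ⟩
  2 * k * toℕ (row j) + column (rowLayout (row j)) k (toℕ (side j)) (toℕ x)
    ≡⟨ cong (λ y → 2 * k * toℕ (row j) + column (rowLayout (row j)) k (toℕ (side j)) y)
            (toℕ-orientation (reversed j) i) ⟩
  pred (edgeLabel k (toℕ i) (toℕ (opposite i)) j)
    ∎)
  where
  open ≡-Reasoning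
  x : Fin k
  x = orientation (reversed j) ⟨$⟩ʳ i
  c : Fin (2 * k)
  c = Inverse.to (layout k (rowLayout (row j))) (side j , x)

colourClass : Fin 8 → Fin 3
colourClass 1F = 1F
colourClass 3F = 1F
colourClass 5F = 2F
colourClass _  = 0F

colourClass-proper : ∀ e → colourClass (proj₁ (ends B8 e)) ≢ colourClass (proj₂ (ends B8 e))
colourClass-proper = toWitness
  {a? = all? λ e → ¬? (colourClass (proj₁ (ends B8 e)) ≟ᶠ colourClass (proj₂ (ends B8 e)))} tt

palette : ℕ → Fin 3 → ℕ
palette k 0F = 10 * k + 1
palette k 1F = 16 * k + 2
palette k 2F = 18 * k + 1

palette-<₀₁ : ∀ k → palette k 0F < palette k 1F
palette-<₀₁ k = +-mono-≤-< (*-monoˡ-≤ k (m≤m+n 10 6)) (n<1+n 1)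

palette-<₁₂ : ∀ k → .{{NonZero k}} → palette k 1F < palette k 2F
palette-<₁₂ k = begin-strict
  16 * k + 2     ≤⟨ +-monoʳ-≤ (16 * k) (*-monoʳ-≤ 2 (>-nonZero⁻¹ k)) ⟩
  16 * k + 2 * k ≡⟨ *-distribʳ-+ k 16 2 ⟨
  18 * k         <⟨ m<m+n (18 * k) z<s ⟩
  18 * k + 1     ∎
  where open ≤-Reasoning

palette-<₀₂ : ∀ k → .{{NonZero k}} → palette k 0F < palette k 2F
palette-<₀₂ k = <-trans (palette-<₀₁ k) (palette-<₁₂ k)

palette-injective : ∀ k → .{{NonZero k}} → Injective _≡_ _≡_ (palette k)
palette-injective k {0F} {0F} _  = refl
palette-injective k {0F} {1F} eq = contradiction eq (<⇒≢ (palette-<₀₁ k))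
palette-injective k {0F} {2F} eq = contradiction eq (<⇒≢ (palette-<₀₂ k))
palette-injective k {1F} {0F} eq = contradiction eq (>⇒≢ (palette-<₀₁ k))
palette-injective k {1F} {1F} _  = refl
palette-injective k {1F} {2F} eq = contradiction eq (<⇒≢ (palette-<₁₂ k))
palette-injective k {2F} {0F} eq = contradiction eq (>⇒≢ (palette-<₀₂ k))
palette-injective k {2F} {1F} eq = contradiction eq (>⇒≢ (palette-<₁₂ k))
palette-injective k {2F} {2F} _  = refl

-- The left-hand sides are the unfolded sums of edgeLabel over the edges at each vertex,
-- spelled out for the ring solver.
vertexSum-B8 : ∀ t o v →
               vsumBy B8 (edgeLabel (suc (t + o)) t o) v ≡ palette (suc (t + o)) (colourClass v)
vertexSum-B8 t o = λ where
    0F → at-u₁ t o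
    1F → at-u₂ t o
    2F → at-u₃ t o
    3F → at-u₄ t o
    4F → at-u₅ t o
    5F → at-u₆ t o
    6F → at-u₇ t o
    7F → at-x t o
  where
  at-u₁ : ∀ t o → let k = suc (t + o) in
          suc (2 * k * 4 + (2 * o + 1)) + (suc (2 * k * 0 + (2 * t + 0)) + 0) ≡ 10 * k + 1
  at-u₁ = solve-∀
  at-u₂ : ∀ t o → let k = suc (t + o) in
          suc (2 * k * 4 + (2 * o + 1)) +
            (suc (2 * k * 1 + (k * 0 + t)) + (suc (2 * k * 2 + (k * 0 + t)) + 0)) ≡ 16 * k + 2
  at-u₂ = solve-∀
  at-u₃ : ∀ t o → let k = suc (t + o) in
          suc (2 * k * 1 + (k * 0 + t)) + (suc (2 * k * 3 + (k * 1 + o)) + 0) ≡ 10 * k + 1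
  at-u₃ = solve-∀
  at-u₄ : ∀ t o → let k = suc (t + o) in
          suc (2 * k * 3 + (k * 1 + o)) + (suc (2 * k * 0 + (2 * o + 1)) +
            (suc (2 * k * 3 + (k * 0 + t)) + (suc (2 * k * 0 + (2 * t + 0)) + 0))) ≡ 16 * k + 2
  at-u₄ = solve-∀
  at-u₅ : ∀ t o → let k = suc (t + o) in
          suc (2 * k * 0 + (2 * o + 1)) + (suc (2 * k * 4 + (2 * t + 0)) + 0) ≡ 10 * k + 1
  at-u₅ = solve-∀
  at-u₆ : ∀ t o → let k = suc (t + o) in
          suc (2 * k * 4 + (2 * t + 0)) +
            (suc (2 * k * 1 + (k * 1 + o)) + (suc (2 * k * 2 + (k * 1 + o)) + 0)) ≡ 18 * k + 1
  at-u₆ = solve-∀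
  at-u₇ : ∀ t o → let k = suc (t + o) in
          suc (2 * k * 1 + (k * 1 + o)) + (suc (2 * k * 3 + (k * 0 + t)) + 0) ≡ 10 * k + 1
  at-u₇ = solve-∀
  at-x : ∀ t o → let k = suc (t + o) in
         suc (2 * k * 2 + (k * 0 + t)) + (suc (2 * k * 2 + (k * 1 + o)) + 0) ≡ 10 * k + 1
  at-x = solve-∀

toℕ+toℕ-opposite : ∀ {n} (i : Fin n) → suc (toℕ i + toℕ (opposite i)) ≡ n
toℕ+toℕ-opposite i = trans (cong (suc (toℕ i) +_) (opposite-prop i)) (m+[n∸m]≡n (toℕ<n i))

vsum-labeling : ∀ k (i : Fin k) v →
                vsum (B k) (labeling k) (combine i v) ≡ palette k (colourClass v)
vsum-labeling k i v = begin
  vsum (B k) (labeling k) (combine i v)              ≡⟨ vsumBy-Copies k B8 _ i v ⟩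
  vsumBy B8 (label (B k) (labeling k) ∘ combine i) v ≡⟨ vsumBy-cong B8 (label-combine k i) v ⟩
  vsumBy B8 (edgeLabel k t o) v                      ≡⟨ subst sumIsColour (toℕ+toℕ-opposite i)
                                                               (vertexSum-B8 t o v) ⟩
  palette k (colourClass v)                          ∎
  where
  open ≡-Reasoning
  t o : ℕ
  t = toℕ i
  o = toℕ (opposite i)
  sumIsColour : ℕ → Set
  sumIsColour n = vsumBy B8 (edgeLabel n t o) v ≡ palette n (colourClass v)

labeling-isLocalAntimagic : ∀ k → .{{NonZero k}} → IsLocalAntimagic (B k) (labeling k)
labeling-isLocalAntimagic k =
  Copies-isLocalAntimagic {H = B8} (labeling k) (palette k ∘ colourClass) (vsum-labeling k)
    (λ e → colourClass-proper e ∘ palette-injective k)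

labeling-numColors≤3 : ∀ k → numColors (B k) (labeling k) ≤ 3
labeling-numColors≤3 k =
  numColors≤length (B k) (labeling k) (map (palette k) (allFin 3)) vsum∈palette
  where
  vsum∈palette : ∀ v → vsum (B k) (labeling k) v ∈ map (palette k) (allFin 3)
  vsum∈palette v with i , j , refl ← combine-surjective {k} {8} v =
    subst (_∈ _) (sym (vsum-labeling k i j)) (∈-map⁺ (palette k) (∈-allFin (colourClass j)))

theorem4p3 : ∀ (k : ℕ) → 1 ≤ k → ∃[ c ] (ChiLa (B k) c × 2 ≤ c × c ≤ 3)
theorem4p3 k@(suc _) _ = bounds (chiLa-exists (B k) (labeling k) antimagic)
  where
  antimagic : IsLocalAntimagic (B k) (labeling k)
  antimagic = labeling-isLocalAntimagic k
  bounds : ∃ (ChiLa (B k)) → ∃[ c ] (ChiLa (B k) c × 2 ≤ c × c ≤ 3)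
  bounds (c , χ) =
    c , χ , chiLa≥2 (B k) zero χ , ≤-trans (proj₂ χ (labeling k) antimagic) (labeling-numColors≤3 k)
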